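{- For every integer $n\geq 2$: (i) $\pi(F_{n,4})=3n+10$; (ii) $\pi^{*}(F_{n,4})=4$; (iii) $\pi^{*}_{2}(F_{n,4})=4$ if $n=2$, $\pi^{*}_{2}(F_{n,4})=5$ if $n=3$, and $\pi^{*}_{2}(F_{n,4})=6$ if $n\geq 4$.
   Context: Let $G=(V,E)$ be a simple connected graph. A configuration is a function $f:V\to\mathbb{N}\cup\{0\}$, with weight $|f|=\sum_{u\in V}f(u)$. A pebbling step from a vertex $u$ to a neighbor $v$ decreases $f(u)$ by two and increases $f(v)$ by one. A configuration is solvable if for every vertex $v$ there is a (possibly empty) sequence of pebbling steps resulting in at least one pebble on $v$. The pebbling number $\pi(G)$ is the minimum $k$ such that every configuration of weight $k$ is solvable. The optimal pebbling number $\pi^{*}(G)$ is the minimum weight of a solvable configuration. A configuration $f$ is $2$-restricted if $f(v)\leq 2$ for all $v\in V$ (the restriction applies only to the initial configuration); the $2$-restricted optimal pebbling number $\pi^{*}_{2}(G)$ is the minimum weight of a solvable $2$-restricted configuration. The generalized friendship graph $F_{n,m}$ consists of $n$ cycles, each of order $m$, all sharing exactly one common vertex $v$ and otherwise pairwise disjoint. -}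

module Defs where

open import Data.Nat using (ℕ; zero; suc; _∸_; _≤_; _<_)
open import Data.Fin using (Fin; zero; suc; combine; _≟_)
open import Data.Vec using (tabulate; sum)
open import Data.Bool using (if_then_else_)
open import Data.Product using (Σ; ∃; _×_; _,_)
open import Relation.Nullary using (¬_)
open import Relation.Binary.PropositionalEquality using (_≡_)
open import Relation.Nullary.Decidable using (⌊_⌋)
open import Relation.Binary.Construct.Closure.ReflexiveTransitive using (Star)

record Graph : Set₁ where
  field
    N   : ℕ
    Adj : Fin N → Fin N → Set

open Graph public

Config : Graph → Set
Config G = Fin (N G) → ℕ

weight : (G : Graph) → Config G → ℕ
weight G f = sum (tabulate f)

move : (G : Graph) → Config G → Fin (N G) → Fin (N G) → Config G
move G f u v w =
  if ⌊ w ≟ u ⌋ then f w ∸ 2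
  else (if ⌊ w ≟ v ⌋ then suc (f w) else f w)

data Step (G : Graph) (f : Config G) : Config G → Set where
  step : (u v : Fin (N G)) → Adj G u v → 2 ≤ f u → Step G f (move G f u v)

Reach : (G : Graph) → Config G → Config G → Set
Reach G = Star (Step G)

Solvable : (G : Graph) → Config G → Set
Solvable G f = (v : Fin (N G)) → Σ (Config G) λ g → Reach G f g × 1 ≤ g v

TwoRestricted : (G : Graph) → Config G → Set
TwoRestricted G f = (v : Fin (N G)) → f v ≤ 2

IsLeast : (ℕ → Set) → ℕ → Set
IsLeast P m = P m × ((k : ℕ) → k < m → ¬ P k)

PebblingNumber : Graph → ℕ → Set
PebblingNumber G = IsLeast (λ k → (f : Config G) → weight G f ≡ k → Solvable G f)

OptimalPebblingNumber : Graph → ℕ → Set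
OptimalPebblingNumber G = IsLeast (λ k → Σ (Config G) λ f → weight G f ≡ k × Solvable G f)

TwoRestrictedOptimalPebblingNumber : Graph → ℕ → Set
TwoRestrictedOptimalPebblingNumber G =
  IsLeast (λ k → Σ (Config G) λ f → weight G f ≡ k × TwoRestricted G f × Solvable G f)

-- Generalized friendship graph F_{n,4}: vertex 0 is the common vertex v;
-- cycle i (i : Fin n) is  v - c i 0 - c i 1 - c i 2 - v.

c : {n : ℕ} → Fin n → Fin 3 → Fin (suc (n Data.Nat.* 3))
c i j = suc (combine i j)

data FAdj (n : ℕ) : Fin (suc (n Data.Nat.* 3)) → Fin (suc (n Data.Nat.* 3)) → Set where
  hub-0 : (i : Fin n) → FAdj n zero (c i zero)
  0-hub : (i : Fin n) → FAdj n (c i zero) zero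
  0-1   : (i : Fin n) → FAdj n (c i zero) (c i (suc zero))
  1-0   : (i : Fin n) → FAdj n (c i (suc zero)) (c i zero)
  1-2   : (i : Fin n) → FAdj n (c i (suc zero)) (c i (suc (suc zero)))
  2-1   : (i : Fin n) → FAdj n (c i (suc (suc zero))) (c i (suc zero))
  2-hub : (i : Fin n) → FAdj n (c i (suc (suc zero))) zero
  hub-2 : (i : Fin n) → FAdj n zero (c i (suc (suc zero)))

F4 : ℕ → Graph
F4 n = record { N = suc (n Data.Nat.* 3) ; Adj = FAdj n }

{-# OPTIONS --safe #-}
module Submission where

-- A petal (the three non-hub vertices of one 4-cycle) carrying s pebbles can send ⌊s/4⌋ pebbles
-- to the hub. Collecting these from every petal except the target's turns any configuration of
-- 3n + 10 pebbles into one whose target 4-cycle has h pebbles on the hub and s on its petal with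
-- 4h + s ≥ 13, and every such configuration of the 4-cycle reaches all of its vertices.
--
-- The lower bounds are potential arguments: the hub count plus a weight φ(x, y, z) of each petal
-- (x and z next to the hub, y opposite it) never increases along a pebbling move. Away from the
-- target the weight is ⌊(2x + y + 2z)/4⌋, a bound on what the petal can ever deliver to the hub;
-- on the target petal it is 2x + 4y + 2z when y is the target and 2x + 2⌊y/2⌋ + 2z when x is.
-- Hence 15 pebbles opposite the hub in one petal and 3 opposite the hub in all petals but two
-- (3n + 9 pebbles) never reach the middle of the empty petal, and no configuration with at most
-- n + 1 pebbles, and at most 7 when the hub is counted twice, is solvable. The upper bounds for
-- the optimal numbers come from 4 pebbles on the hub, from 2 on the hub and one opposite the hub
-- in every petal, and from 2 on the hub and 2 on both hub-neighbours of one petal.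

open import Defs
open import Data.Nat using (ℕ; zero; suc; _≤_; _<_; _+_; _*_; _∸_; z≤n; s≤s; _≤?_; ⌊_/2⌋)
open import Data.Nat.Properties hiding (_≟_; suc-injective)
open import Data.Nat.Properties using () renaming (_≟_ to _≟ℕ_)
open import Data.Nat.DivMod
  using (_/_; _%_; m/n*n≤m; m≡m%n+[m/n]*n; m%n<n; /-monoˡ-≤; +-distrib-/-∣ʳ; m*n/n≡m)
open import Data.Nat.Divisibility using (n∣m*n)
open import Data.Nat.Tactic.RingSolver using (solve; solve-∀)
open import Data.Fin using (Fin; zero; suc; _≟_; combine; remQuot)
open import Data.Fin.Patterns using (0F; 1F; 2F; 3F)
open import Data.Fin.Properties
  using (any?; punchInᵢ≢i; combine-injective; combine-surjective; remQuot-combine; suc-injective)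
open import Data.Vec using (tabulate)
import Data.Vec as Vec
open import Data.Vec.Functional using (removeAt)
open import Data.List using (_∷_; [])
open import Data.Bool using (if_then_else_)
open import Data.Product using (Σ; ∃-syntax; _×_; _,_; proj₁; proj₂; uncurry)
open import Data.Empty using (⊥)
open import Function using (_∘_)
open import Function.Definitions using (Injective)
open import Relation.Nullary using (yes; no; ¬_; contradiction)
open import Relation.Nullary.Decidable using (⌊_⌋; from-yes)
open import Relation.Binary.PropositionalEquality
open import Relation.Binary.Construct.Closure.ReflexiveTransitive using (ε; _◅_; _◅◅_)
open import Algebra.Properties.CommutativeSemigroup +-commutativeSemigroup
  using (x∙yz≈y∙xz; x∙yz≈xz∙y)
open import Algebra.Properties.Semiring.Sum +-*-semiring
  using (sum; sum-syntax; sum-remove; sum-cong-≗; sum-replicate-zero; ∑-distrib-+; *-distribʳ-sum)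

-- Pebbling on arbitrary graphs

infix 4 _≤ᶜ_
_≤ᶜ_ : {A : Set} → (A → ℕ) → (A → ℕ) → Set
f ≤ᶜ g = ∀ x → f x ≤ g x

infixl 6 _⊕_
_⊕_ : {A : Set} → (A → ℕ) → (A → ℕ) → A → ℕ
(f ⊕ g) x = f x + g x

∑ᶜ : {A : Set} {m : ℕ} → (Fin m → A → ℕ) → A → ℕ
∑ᶜ {m = m} F x = ∑[ k < m ] F k x

record Covers (G : Graph) (f g : Config G) : Set where
  constructor covers
  field
    {reached}  : Config G
    reach      : Reach G f reached
    dominated  : g ≤ᶜ reached

syntax Covers G f g = f ⇝[ G ] g

Pebbles : (G : Graph) → Config G → Fin (N G) → Set
Pebbles G f v = Σ (Config G) λ g → Reach G f g × 1 ≤ g v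

module _ {G : Graph} where

  move-other : ∀ (f : Config G) {u v w} → w ≢ u → w ≢ v → move G f u v w ≡ f w
  move-other f {u} {v} {w} w≢u w≢v with w ≟ u | w ≟ v
  ... | yes w≡u | _      = contradiction w≡u w≢u
  ... | no _    | yes w≡v = contradiction w≡v w≢v
  ... | no _    | no _    = refl

  move-cong : ∀ {f f′ : Config G} u v {w} → f w ≡ f′ w → move G f u v w ≡ move G f′ u v w
  move-cong u v {w} = cong (λ t → if ⌊ w ≟ u ⌋ then t ∸ 2 else (if ⌊ w ≟ v ⌋ then suc t else t))

  move-frame : ∀ {f f′ e : Config G} u v → 2 ≤ f u → f ⊕ e ≤ᶜ f′ → move G f u v ⊕ e ≤ᶜ move G f′ u v
  move-frame {e = e} u v 2≤ le w with w ≟ u | w ≟ v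
  ... | yes refl | _     = ≤-trans (≤-reflexive (sym (+-∸-comm (e w) 2≤))) (∸-monoˡ-≤ 2 (le w))
  ... | no _     | yes _ = s≤s (le w)
  ... | no _     | no _  = le w

  reach-frame : ∀ {f g f′ e : Config G} → Reach G f g → f ⊕ e ≤ᶜ f′ → f′ ⇝[ G ] (g ⊕ e)
  reach-frame ε le = covers ε le
  reach-frame {f} {e = e} (step u v uv 2≤ ◅ r) le =
    let covers r′ le′ = reach-frame r (move-frame u v 2≤ le)
    in  covers (step u v uv (≤-trans 2≤ (≤-trans (m≤m+n (f u) (e u)) (le u))) ◅ r′) le′

  reach-mono : ∀ {f g f′ : Config G} → Reach G f g → f ≤ᶜ f′ → f′ ⇝[ G ] g
  reach-mono {f} r le =
    let covers r′ le′ = reach-frame {e = λ _ → 0} r (λ w → ≤-trans (≤-reflexive (+-identityʳ (f w))) (le w))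
    in  covers r′ (λ w → ≤-trans (≤-reflexive (sym (+-identityʳ _))) (le′ w))

  ≤⇒⇝ : ∀ {f g : Config G} → g ≤ᶜ f → f ⇝[ G ] g
  ≤⇒⇝ = covers ε

  ⇝-weaken : ∀ {f f′ g g′ : Config G} → f ≤ᶜ f′ → g′ ≤ᶜ g → f ⇝[ G ] g → f′ ⇝[ G ] g′
  ⇝-weaken f≤ g′≤ (covers r le) =
    let covers r′ le′ = reach-mono r f≤ in covers r′ (λ w → ≤-trans (g′≤ w) (≤-trans (le w) (le′ w)))

  ⇝-trans : ∀ {f g h : Config G} → f ⇝[ G ] g → g ⇝[ G ] h → f ⇝[ G ] h
  ⇝-trans (covers r le) g⇝h = let covers r′ le′ = ⇝-weaken le (λ _ → ≤-refl) g⇝h in covers (r ◅◅ r′) le′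

  ⇝-frame : ∀ {f g : Config G} e → f ⇝[ G ] g → (f ⊕ e) ⇝[ G ] (g ⊕ e)
  ⇝-frame e (covers r le) =
    let covers r′ le′ = reach-frame r (λ _ → ≤-refl)
    in  covers r′ (λ w → ≤-trans (+-monoˡ-≤ (e w) (le w)) (le′ w))

  ⇝-+ : ∀ {f₁ g₁ f₂ g₂ : Config G} → f₁ ⇝[ G ] g₁ → f₂ ⇝[ G ] g₂ → (f₁ ⊕ f₂) ⇝[ G ] (g₁ ⊕ g₂)
  ⇝-+ {_} {g₁} {f₂} {g₂} d₁ d₂ =
    ⇝-trans (⇝-frame f₂ d₁)
      (⇝-weaken (λ w → ≤-reflexive (+-comm (f₂ w) (g₁ w))) (λ w → ≤-reflexive (+-comm (g₁ w) (g₂ w)))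
        (⇝-frame g₁ d₂))

  ⇝-∑ : ∀ {m} {F F′ : Fin m → Config G} → (∀ k → F k ⇝[ G ] F′ k) → ∑ᶜ F ⇝[ G ] ∑ᶜ F′
  ⇝-∑ {zero}  d = ≤⇒⇝ (λ _ → z≤n)
  ⇝-∑ {suc m} d = ⇝-+ (d zero) (⇝-∑ (λ k → d (suc k)))

  step⇝ : ∀ {f : Config G} {u v} → Adj G u v → 2 ≤ f u → f ⇝[ G ] move G f u v
  step⇝ uv 2≤ = covers (step _ _ uv 2≤ ◅ ε) (λ _ → ≤-refl)

  ⇝-pebbles : ∀ {f g : Config G} {v} → f ⇝[ G ] g → Pebbles G g v → Pebbles G f v
  ⇝-pebbles {v = v} (covers r le) (h , r′ , 1≤) =
    let covers r″ le″ = reach-mono r′ le in _ , r ◅◅ r″ , ≤-trans 1≤ (le″ v)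

  pebble-present : ∀ {f : Config G} {v} → 1 ≤ f v → Pebbles G f v
  pebble-present 1≤ = _ , ε , 1≤

  covered-pebble : ∀ {f g : Config G} {v} → f ⇝[ G ] g → 1 ≤ g v → Pebbles G f v
  covered-pebble {v = v} (covers r le) 1≤ = _ , r , ≤-trans 1≤ (le v)

  solvable-⇝ : ∀ {f g : Config G} → f ⇝[ G ] g → Solvable G g → Solvable G f
  solvable-⇝ f⇝g solvable v = ⇝-pebbles f⇝g (solvable v)

shrink-sum : ∀ {m} (f : Fin m → ℕ) {k} → k ≤ Vec.sum (tabulate f) →
             Σ (Fin m → ℕ) λ g → g ≤ᶜ f × Vec.sum (tabulate g) ≡ k
shrink-sum {zero}  f k≤0 = f , (λ ()) , sym (n≤0⇒n≡0 k≤0)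
shrink-sum {suc m} f {k} k≤ with k ≤? Vec.sum (tabulate (f ∘ suc))
... | yes k≤rest =
  let g , g≤ , sum≡ = shrink-sum (f ∘ suc) k≤rest
  in  (λ { zero → 0 ; (suc w) → g w }) , (λ { zero → z≤n ; (suc w) → g≤ w }) , sum≡
... | no k≰rest =
  (λ { zero → k ∸ rest ; (suc w) → f (suc w) }) ,
  (λ { zero → ≤-trans (∸-monoˡ-≤ rest k≤) (≤-reflexive (m+n∸n≡m (f zero) rest)) ; (suc w) → ≤-refl }) ,
  m∸n+n≡m (≰⇒≥ k≰rest)
  where rest = Vec.sum (tabulate (f ∘ suc))

solvable-mono : ∀ {G} {f f′ : Config G} → f ≤ᶜ f′ → Solvable G f → Solvable G f′
solvable-mono f≤f′ = solvable-⇝ (≤⇒⇝ f≤f′)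

record Embedding (H G : Graph) : Set where
  field
    vertex    : Fin (N H) → Fin (N G)
    injective : Injective _≡_ _≡_ vertex
    adjacent  : ∀ {u v} → Adj H u v → Adj G (vertex u) (vertex v)

module _ {H G : Graph} (ι : Embedding H G) where
  open Embedding ι

  push : Config H → Config G
  push e w with any? (λ x → vertex x ≟ w)
  ... | yes (x , _) = e x
  ... | no _        = 0

  push-vertex : ∀ e x → push e (vertex x) ≡ e x
  push-vertex e x with any? (λ y → vertex y ≟ vertex x)
  ... | yes (y , eq) = cong e (injective eq)
  ... | no ∄         = contradiction (x , refl) ∄

  push-outside : ∀ e {w} → (∀ x → vertex x ≢ w) → push e w ≡ 0
  push-outside e {w} ∉ with any? (λ x → vertex x ≟ w)
  ... | yes (x , eq) = contradiction eq (∉ x)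
  ... | no _         = refl

  push-≤ : ∀ {e : Config H} {f : Config G} → (∀ x → e x ≤ f (vertex x)) → push e ≤ᶜ f
  push-≤ e≤ w with any? (λ x → vertex x ≟ w)
  ... | yes (x , refl) = e≤ x
  ... | no _           = z≤n

  vertex-≟ : ∀ x y → ⌊ vertex x ≟ vertex y ⌋ ≡ ⌊ x ≟ y ⌋
  vertex-≟ x y with x ≟ y | vertex x ≟ vertex y
  ... | yes _   | yes _   = refl
  ... | no _    | no _    = refl
  ... | yes x≡y | no ≢    = contradiction (cong vertex x≡y) ≢
  ... | no x≢y  | yes eq  = contradiction (injective eq) x≢y

  move-vertex : ∀ g u v x → move G g (vertex u) (vertex v) (vertex x) ≡ move H (g ∘ vertex) u v x
  move-vertex g u v x rewrite vertex-≟ x u | vertex-≟ x v = refl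

  push-move : ∀ e u v → push (move H e u v) ≤ᶜ move G (push e) (vertex u) (vertex v)
  push-move e u v =
    push-≤ λ x → ≤-reflexive (sym (trans (move-vertex (push e) u v x)
                                         (move-cong {G = H} {push e ∘ vertex} {e} u v (push-vertex e x))))

  reach-push : ∀ {e e′} → Reach H e e′ → push e ⇝[ G ] push e′
  reach-push ε = ≤⇒⇝ (λ _ → ≤-refl)
  reach-push {e} (step u v uv 2≤ ◅ r) =
    ⇝-trans (⇝-weaken (λ _ → ≤-refl) (push-move e u v)
               (step⇝ (adjacent uv) (subst (2 ≤_) (sym (push-vertex e u)) 2≤)))
            (reach-push r)

  ⇝-push : ∀ {e e′} → e ⇝[ H ] e′ → push e ⇝[ G ] push e′
  ⇝-push (covers r le) =
    ⇝-weaken (λ _ → ≤-refl) (push-≤ (λ x → ≤-trans (le x) (≤-reflexive (sym (push-vertex _ x))))) (reach-push r)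

  pebbles-push : ∀ {e t} → Pebbles H e t → Pebbles G (push e) (vertex t)
  pebbles-push (h , r , 1≤) = covered-pebble (reach-push r) (subst (1 ≤_) (sym (push-vertex h _)) 1≤)

sum-const : ∀ n c → ∑[ k < n ] c ≡ n * c
sum-const zero    c = refl
sum-const (suc n) c = cong (c +_) (sum-const n c)

sum-zero : ∀ {n} {a : Fin n → ℕ} → (∀ k → a k ≡ 0) → sum a ≡ 0
sum-zero {n} a≡0 = trans (sum-cong-≗ a≡0) (sum-replicate-zero n)

sum-mono : ∀ {n} {a b : Fin n → ℕ} → a ≤ᶜ b → sum a ≤ sum b
sum-mono {zero}  a≤b = z≤n
sum-mono {suc n} a≤b = +-mono-≤ (a≤b zero) (sum-mono (a≤b ∘ suc))

term≤sum : ∀ {n} (a : Fin n → ℕ) i → a i ≤ sum a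
term≤sum {suc n} a i = ≤-trans (m≤m+n (a i) _) (≤-reflexive (sym (sum-remove {i = i} a)))

sum-single : ∀ {n} (i : Fin n) {a : Fin n → ℕ} → (∀ k → k ≢ i → a k ≡ 0) → sum a ≡ a i
sum-single {suc n} i {a} elsewhere = begin
  sum a                         ≡⟨ sum-remove {i = i} a ⟩
  a i + sum (removeAt a i)      ≡⟨ cong (a i +_) (sum-zero λ k → elsewhere _ (punchInᵢ≢i i k)) ⟩
  a i + 0                       ≡⟨ +-identityʳ (a i) ⟩
  a i                           ∎
  where open ≡-Reasoning

sum-≤-except : ∀ {n} (i : Fin n) {a b : Fin n → ℕ} {c d} →
               c + a i ≤ d + b i → (∀ k → k ≢ i → a k ≤ b k) → c + sum a ≤ d + sum b
sum-≤-except {suc n} i {a} {b} {c} {d} at-i elsewhere = begin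
  c + sum a                        ≡⟨ cong (c +_) (sum-remove {i = i} a) ⟩
  c + (a i + sum (removeAt a i))   ≡⟨ +-assoc c (a i) _ ⟨
  c + a i + sum (removeAt a i)     ≤⟨ +-mono-≤ at-i (sum-mono (λ k → elsewhere _ (punchInᵢ≢i i k))) ⟩
  d + b i + sum (removeAt b i)     ≡⟨ +-assoc d (b i) _ ⟩
  d + (b i + sum (removeAt b i))   ≡⟨ cong (d +_) (sum-remove {i = i} b) ⟨
  d + sum b                        ∎
  where open ≤-Reasoning

-- The 4-cycle

data C4Adj : Fin 4 → Fin 4 → Set where
  0→1 : C4Adj 0F 1F
  1→0 : C4Adj 1F 0F
  1→2 : C4Adj 1F 2F
  2→1 : C4Adj 2F 1F
  2→3 : C4Adj 2F 3F
  3→2 : C4Adj 3F 2F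
  3→0 : C4Adj 3F 0F
  0→3 : C4Adj 0F 3F

C4 : Graph
C4 = record { N = 4 ; Adj = C4Adj }

cfg : ℕ → ℕ → ℕ → ℕ → Config C4
cfg h x y z 0F = h
cfg h x y z 1F = x
cfg h x y z 2F = y
cfg h x y z 3F = z

on4 : ∀ {P : Fin 4 → Set} → P 0F → P 1F → P 2F → P 3F → ∀ w → P w
on4 p₀ p₁ p₂ p₃ 0F = p₀
on4 p₀ p₁ p₂ p₃ 1F = p₁
on4 p₀ p₁ p₂ p₃ 2F = p₂
on4 p₀ p₁ p₂ p₃ 3F = p₃

move⇝ : ∀ {e e′ : Config C4} {u v} → C4Adj u v → 2 ≤ e u → (∀ w → e′ w ≡ move C4 e u v w) → e ⇝[ C4 ] e′
move⇝ uv 2≤ e′≡ = ⇝-weaken (λ _ → ≤-refl) (λ w → ≤-reflexive (e′≡ w)) (step⇝ uv 2≤)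

module _ {h x y z : ℕ} where

  move₀₁ : cfg (2 + h) x y z ⇝[ C4 ] cfg h (suc x) y z
  move₀₁ = move⇝ 0→1 (s≤s (s≤s z≤n)) (on4 refl refl refl refl)

  move₁₀ : cfg h (2 + x) y z ⇝[ C4 ] cfg (suc h) x y z
  move₁₀ = move⇝ 1→0 (s≤s (s≤s z≤n)) (on4 refl refl refl refl)

  move₁₂ : cfg h (2 + x) y z ⇝[ C4 ] cfg h x (suc y) z
  move₁₂ = move⇝ 1→2 (s≤s (s≤s z≤n)) (on4 refl refl refl refl)

  move₂₁ : cfg h x (2 + y) z ⇝[ C4 ] cfg h (suc x) y z
  move₂₁ = move⇝ 2→1 (s≤s (s≤s z≤n)) (on4 refl refl refl refl)

  move₂₃ : cfg h x (2 + y) z ⇝[ C4 ] cfg h x y (suc z)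
  move₂₃ = move⇝ 2→3 (s≤s (s≤s z≤n)) (on4 refl refl refl refl)

  move₃₂ : cfg h x y (2 + z) ⇝[ C4 ] cfg h x (suc y) z
  move₃₂ = move⇝ 3→2 (s≤s (s≤s z≤n)) (on4 refl refl refl refl)

  move₃₀ : cfg h x y (2 + z) ⇝[ C4 ] cfg (suc h) x y z
  move₃₀ = move⇝ 3→0 (s≤s (s≤s z≤n)) (on4 refl refl refl refl)

  move₀₃ : cfg (2 + h) x y z ⇝[ C4 ] cfg h x y (suc z)
  move₀₃ = move⇝ 0→3 (s≤s (s≤s z≤n)) (on4 refl refl refl refl)

spent≤4 : ∀ k {s t} → k ≤ 4 → s ≡ k + t → s ≤ 4 + t
spent≤4 k {t = t} k≤4 refl = +-monoˡ-≤ t k≤4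

one-to-hub : ∀ h x y z → 4 ≤ x + y + z → ∃[ x′ ] ∃[ y′ ] ∃[ z′ ]
             (x + y + z ≤ 4 + (x′ + y′ + z′) × cfg h x y z ⇝[ C4 ] cfg (suc h) x′ y′ z′)
one-to-hub h (suc (suc x)) y z _ = x , y , z , spent≤4 2 (s≤s (s≤s z≤n)) refl , move₁₀
one-to-hub h x y (suc (suc z)) _ =
  x , y , z , spent≤4 2 (s≤s (s≤s z≤n)) (trans (+-suc (x + y) (suc z)) (cong suc (+-suc (x + y) z))) , move₃₀
one-to-hub h 1 (suc (suc y)) z _ =
  0 , y , z , spent≤4 3 (s≤s (s≤s (s≤s z≤n))) refl , ⇝-trans move₂₁ move₁₀
one-to-hub h 0 (suc (suc y)) 1 _ =
  0 , y , 0 , spent≤4 3 (s≤s (s≤s (s≤s z≤n))) (cong (2 +_) (+-suc y 0)) , ⇝-trans move₂₃ move₃₀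
one-to-hub h 0 (suc (suc (suc (suc y)))) 0 _ =
  0 , y , 0 , spent≤4 4 ≤-refl refl , ⇝-trans move₂₁ (⇝-trans move₂₁ move₁₀)
one-to-hub h 0 0 0 ()
one-to-hub h 0 1 0 (s≤s ())
one-to-hub h 0 2 0 (s≤s (s≤s ()))
one-to-hub h 0 3 0 (s≤s (s≤s (s≤s ())))
one-to-hub h 0 0 1 (s≤s ())
one-to-hub h 0 1 1 (s≤s (s≤s ()))
one-to-hub h 1 0 0 (s≤s ())
one-to-hub h 1 0 1 (s≤s (s≤s ()))
one-to-hub h 1 1 0 (s≤s (s≤s ()))
one-to-hub h 1 1 1 (s≤s (s≤s (s≤s ())))

deliver : ∀ d {h x y z} → d * 4 ≤ x + y + z → cfg h x y z ⇝[ C4 ] cfg (h + d) 0 0 0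
deliver zero    {h} _ = ≤⇒⇝ (on4 (≤-reflexive (+-identityʳ h)) z≤n z≤n z≤n)
deliver (suc d) {h} {x} {y} {z} 4+d*4≤ with one-to-hub h x y z (≤-trans (m≤m+n 4 (d * 4)) 4+d*4≤)
... | _ , _ , _ , s≤4+s′ , first =
  ⇝-trans first (⇝-weaken (λ _ → ≤-refl) (on4 (≤-reflexive (+-suc h d)) z≤n z≤n z≤n)
                  (deliver d (+-cancelˡ-≤ 4 _ _ (≤-trans 4+d*4≤ s≤4+s′))))

deliver-all : ∀ {h x y z} → cfg h x y z ⇝[ C4 ] cfg (h + (x + y + z) / 4) 0 0 0
deliver-all {x = x} {y} {z} = deliver _ (m/n*n≤m (x + y + z) 4)

quarter-bound : ∀ s → s ≤ s / 4 * 4 + 3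
quarter-bound s = begin
  s                 ≡⟨ m≡m%n+[m/n]*n s 4 ⟩
  s % 4 + s / 4 * 4 ≤⟨ +-monoˡ-≤ (s / 4 * 4) (≤-pred (m%n<n s 4)) ⟩
  3 + s / 4 * 4     ≡⟨ +-comm 3 _ ⟩
  s / 4 * 4 + 3     ∎
  where open ≤-Reasoning

hub-exceeds : ∀ k {h s} → 13 ≤ h * 4 + s → k * 4 + s ≤ 12 → k < h
hub-exceeds k {h} {s} 13≤ small =
  ≰⇒> λ h≤k → <-irrefl refl (≤-trans 13≤ (≤-trans (+-monoˡ-≤ s (*-monoˡ-≤ 4 h≤k)) small))

module _ {x y z : ℕ} where

  hub-to-1 : ∀ {h} → 2 ≤ h → Pebbles C4 (cfg h x y z) 1F
  hub-to-1 (s≤s (s≤s _)) = covered-pebble move₀₁ (s≤s z≤n)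

  hub-to-3 : ∀ {h} → 2 ≤ h → Pebbles C4 (cfg h x y z) 3F
  hub-to-3 (s≤s (s≤s _)) = covered-pebble move₀₃ (s≤s z≤n)

opposite-via-1 : ∀ {h y z} → 2 ≤ h → Pebbles C4 (cfg h 1 y z) 2F
opposite-via-1 (s≤s (s≤s _)) = covered-pebble (⇝-trans move₀₁ move₁₂) (s≤s z≤n)

opposite-via-3 : ∀ {h x y} → 2 ≤ h → Pebbles C4 (cfg h x y 1) 2F
opposite-via-3 (s≤s (s≤s _)) = covered-pebble (⇝-trans move₀₃ move₃₂) (s≤s z≤n)

opposite-from-hub : ∀ {h x y z} → 4 ≤ h → Pebbles C4 (cfg h x y z) 2F
opposite-from-hub (s≤s (s≤s (s≤s (s≤s _)))) =
  covered-pebble (⇝-trans move₀₁ (⇝-trans move₀₁ move₁₂)) (s≤s z≤n)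

opposite-pebble : ∀ {h x y z} → 13 ≤ h * 4 + (x + y + z) → Pebbles C4 (cfg h x y z) 2F
opposite-pebble {y = suc y} _ = pebble-present (s≤s z≤n)
opposite-pebble {x = suc (suc x)} {y = 0} _ = covered-pebble move₁₂ (s≤s z≤n)
opposite-pebble {y = 0} {z = suc (suc z)} _ = covered-pebble move₃₂ (s≤s z≤n)
opposite-pebble {x = 1} {0} {0} 13≤ = opposite-via-1 (hub-exceeds 1 13≤ (from-yes (5 ≤? 12)))
opposite-pebble {x = 1} {0} {1} 13≤ = opposite-via-1 (hub-exceeds 1 13≤ (from-yes (6 ≤? 12)))
opposite-pebble {x = 0} {0} {1} 13≤ = opposite-via-3 (hub-exceeds 1 13≤ (from-yes (5 ≤? 12)))
opposite-pebble {x = 0} {0} {0} 13≤ = opposite-from-hub (hub-exceeds 3 13≤ (from-yes (12 ≤? 12)))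

cycle-solvable : ∀ {h x y z} → 13 ≤ h * 4 + (x + y + z) → Solvable C4 (cfg h x y z)
cycle-solvable {h} {x} {y} {z} 13≤ = λ
  { 0F → ⇝-pebbles deliver-all (pebble-present (≤-trans (s≤s z≤n) collected≥2))
  ; 1F → ⇝-pebbles deliver-all (hub-to-1 collected≥2)
  ; 2F → opposite-pebble 13≤
  ; 3F → ⇝-pebbles deliver-all (hub-to-3 collected≥2)
  }
  where
  s = x + y + z
  collected≥2 : 2 ≤ h + s / 4
  collected≥2 = <⇒≤ (hub-exceeds 2 (≤-trans 13≤ (begin
    h * 4 + s                 ≤⟨ +-monoʳ-≤ (h * 4) (quarter-bound s) ⟩
    h * 4 + (s / 4 * 4 + 3)   ≡⟨ sym (+-assoc (h * 4) _ 3) ⟩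
    h * 4 + s / 4 * 4 + 3     ≡⟨ cong (_+ 3) (sym (*-distribʳ-+ 4 h (s / 4))) ⟩
    (h + s / 4) * 4 + 3       ∎)) (from-yes (11 ≤? 12)))
    where open ≤-Reasoning

-- The friendship graph F_{n,4}

module _ {n : ℕ} where

  cyc : Fin n → Fin 4 → Fin (suc (n * 3))
  cyc k 0F      = zero
  cyc k (suc r) = c k r

  c-injective : ∀ {k k′ : Fin n} {r r′} → c k r ≡ c k′ r′ → k ≡ k′ × r ≡ r′
  c-injective = combine-injective _ _ _ _ ∘ suc-injective

  cyc-injective : ∀ {k x y} → cyc k x ≡ cyc k y → x ≡ y
  cyc-injective {x = 0F}    {0F}    _  = refl
  cyc-injective {x = suc r} {suc s} eq = cong suc (proj₂ (c-injective eq))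

  cyc-adjacent : ∀ {k u v} → C4Adj u v → FAdj n (cyc k u) (cyc k v)
  cyc-adjacent {k} 0→1 = hub-0 k
  cyc-adjacent {k} 1→0 = 0-hub k
  cyc-adjacent {k} 1→2 = 0-1 k
  cyc-adjacent {k} 2→1 = 1-0 k
  cyc-adjacent {k} 2→3 = 1-2 k
  cyc-adjacent {k} 3→2 = 2-1 k
  cyc-adjacent {k} 3→0 = 2-hub k
  cyc-adjacent {k} 0→3 = hub-2 k

  cycle : Fin n → Embedding C4 (F4 n)
  cycle k = record { vertex = cyc k ; injective = cyc-injective ; adjacent = cyc-adjacent }

  c≢cyc : ∀ {k i} r u → k ≢ i → c k r ≢ cyc i u
  c≢cyc r 0F      k≢i ()
  c≢cyc r (suc s) k≢i eq = k≢i (proj₁ (c-injective eq))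

  by-vertex : ∀ {P : Fin (suc (n * 3)) → Set} → P zero → (∀ k r → P (c k r)) → ∀ w → P w
  by-vertex p₀ pc zero = p₀
  by-vertex p₀ pc (suc w) with combine-surjective {n} w
  ... | k , r , refl = pc k r

  load : Config (F4 n) → Fin n → ℕ
  load f k = f (c k 0F) + f (c k 1F) + f (c k 2F)

  petal : Config (F4 n) → Fin n → Config C4
  petal f k = cfg 0 (f (c k 0F)) (f (c k 1F)) (f (c k 2F))

  hub-only : ℕ → Config (F4 n)
  hub-only h zero    = h
  hub-only h (suc _) = 0

  assemble : ℕ → (Fin n → Fin 3 → ℕ) → Config (F4 n)
  assemble h P zero    = h
  assemble h P (suc w) = uncurry P (remQuot 3 w)

  assemble-c : ∀ h P k r → assemble h P (c k r) ≡ P k r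
  assemble-c h P k r = cong (uncurry P) (remQuot-combine k r)

sum-tabulate-triples : ∀ n (g : Fin (n * 3) → ℕ) →
  Vec.sum (tabulate g) ≡ ∑[ k < n ] (g (combine k 0F) + g (combine k 1F) + g (combine k 2F))
sum-tabulate-triples zero    g = refl
sum-tabulate-triples (suc n) g = begin
  g 0F + (g 1F + (g 2F + Vec.sum (tabulate λ w → g (suc (suc (suc w))))))
    ≡⟨ sym (trans (+-assoc (g 0F + g 1F) (g 2F) _) (+-assoc (g 0F) (g 1F) _)) ⟩
  g 0F + g 1F + g 2F + Vec.sum (tabulate λ w → g (suc (suc (suc w))))
    ≡⟨ cong (g 0F + g 1F + g 2F +_) (sum-tabulate-triples n λ w → g (suc (suc (suc w)))) ⟩
  g 0F + g 1F + g 2F +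
    ∑[ k < n ] (g (combine (suc k) 0F) + g (combine (suc k) 1F) + g (combine (suc k) 2F))    ∎
  where open ≡-Reasoning

weight-F4 : ∀ {n} (f : Config (F4 n)) → weight (F4 n) f ≡ f zero + ∑[ k < n ] load f k
weight-F4 {n} f = cong (f zero +_) (sum-tabulate-triples n (f ∘ suc))

weight-assemble : ∀ {n} h P → weight (F4 n) (assemble h P) ≡ h + ∑[ k < n ] (P k 0F + P k 1F + P k 2F)
weight-assemble {n} h P = trans (weight-F4 {n} (assemble h P)) (cong (h +_) (sum-cong-≗ λ k →
  cong₂ _+_ (cong₂ _+_ (assemble-c h P k 0F) (assemble-c h P k 1F)) (assemble-c h P k 2F)))

solvable-by-cycles : ∀ {m} {f : Config (F4 (suc m))} →
                     (∀ (k : Fin (suc m)) t → Pebbles (F4 (suc m)) f (cyc k t)) → Solvable (F4 (suc m)) f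
solvable-by-cycles p = by-vertex (p zero 0F) (λ k r → p k (suc r))

solvable-by-petals : ∀ {m} {f : Config (F4 (suc m))} {e} →
                     Solvable C4 e → (∀ (k : Fin (suc m)) → push (cycle k) e ≤ᶜ f) → Solvable (F4 (suc m)) f
solvable-by-petals e-solvable e≤f =
  solvable-by-cycles λ k t → ⇝-pebbles (≤⇒⇝ (e≤f k)) (pebbles-push (cycle k) (e-solvable t))

petal-suc : ∀ {n} (f : Config (F4 n)) (k : Fin n) r → petal f k (suc r) ≡ f (c k r)
petal-suc f k 0F = refl
petal-suc f k 1F = refl
petal-suc f k 2F = refl

-- Collecting pebbles on one 4-cycle

module Gathering {n} (f : Config (F4 n)) (j : Fin n) where

  collected : Fin n → Config C4
  collected k = if ⌊ k ≟ j ⌋ then petal f k else cfg (load f k / 4) 0 0 0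

  hub-total : ℕ
  hub-total = f zero + ∑[ k < n ] collected k 0F

  target : Config C4
  target = cfg hub-total (f (c j 0F)) (f (c j 1F)) (f (c j 2F))

  collect : ∀ k → petal f k ⇝[ C4 ] collected k
  collect k with k ≟ j
  ... | yes _ = ≤⇒⇝ (λ _ → ≤-refl)
  ... | no _  = deliver-all

  collected-j : collected j ≡ petal f j
  collected-j with j ≟ j
  ... | yes _   = refl
  ... | no j≢j = contradiction refl j≢j

  decompose : hub-only {n} (f zero) ⊕ ∑ᶜ {m = n} (λ k → push (cycle k) (petal f k)) ≤ᶜ f
  decompose = by-vertex {n} at-hub at-c
    where
    at-hub : f zero + ∑[ k < n ] push (cycle k) (petal f k) zero ≤ f zero
    at-hub = ≤-reflexive (trans (cong (f zero +_) (sum-zero {n} λ k → push-vertex (cycle k) (petal f k) 0F))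
                                (+-identityʳ _))
    at-c : ∀ q r → ∑[ k < n ] push (cycle k) (petal f k) (c q r) ≤ f (c q r)
    at-c q r = ≤-reflexive (begin
      ∑[ k < n ] push (cycle k) (petal f k) (c q r)
        ≡⟨ sum-single q (λ k k≢q → push-outside (cycle k) (petal f k) λ x eq →
                                     c≢cyc r x (k≢q ∘ sym) (sym eq)) ⟩
      push (cycle q) (petal f q) (cyc q (suc r))  ≡⟨ push-vertex (cycle q) (petal f q) (suc r) ⟩
      petal f q (suc r)                           ≡⟨ petal-suc f q r ⟩
      f (c q r)                                   ∎)
      where open ≡-Reasoning

  recompose : push (cycle j) target ≤ᶜ hub-only {n} (f zero) ⊕ ∑ᶜ {m = n} (λ k → push (cycle k) (collected k))
  recompose = push-≤ (cycle j) λ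
    { 0F → ≤-reflexive (cong (f zero +_) (sym (sum-cong-≗ λ k → push-vertex (cycle k) (collected k) 0F)))
    ; 1F → off-hub 0F
    ; 2F → off-hub 1F
    ; 3F → off-hub 2F
    }
    where
    off-hub : ∀ r → f (c j r) ≤ ∑[ k < n ] push (cycle k) (collected k) (c j r)
    off-hub r = ≤-trans (≤-reflexive (sym (trans (push-vertex (cycle j) (collected j) (suc r))
                                              (trans (cong (λ e → e (suc r)) collected-j) (petal-suc f j r)))))
                    (term≤sum (λ k → push (cycle k) (collected k) (c j r)) j)

  gather : f ⇝[ F4 n ] push (cycle j) target
  gather = ⇝-weaken decompose recompose
    (⇝-+ (≤⇒⇝ {f = hub-only (f zero)} (λ _ → ≤-refl)) (⇝-∑ λ k → ⇝-push (cycle k) (collect k)))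

  enough : weight (F4 n) f ≡ 3 * n + 10 → 13 ≤ hub-total * 4 + load f j
  enough weight≡ = +-cancelʳ-≤ (n * 3) 13 _ (begin
    13 + n * 3                                       ≡⟨ shift n ⟩
    3 + (3 * n + 10)                                 ≡⟨ cong (3 +_) (trans (sym weight≡) (weight-F4 {n} f)) ⟩
    3 + (f zero + ∑[ k < n ] load f k)               ≡⟨ x∙yz≈y∙xz 3 (f zero) _ ⟩
    f zero + (3 + ∑[ k < n ] load f k)               ≤⟨ +-monoʳ-≤ (f zero) (sum-≤-except j load-j load≤collected) ⟩
    f zero + (load f j + ∑[ k < n ] (hub k * 4 + 3)) ≡⟨ cong (λ t → f zero + (load f j + t)) sum-hub ⟩
    f zero + (load f j + (∑[ k < n ] hub k * 4 + n * 3))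
                                                     ≤⟨ +-monoˡ-≤ _ (m≤m*n (f zero) 4) ⟩
    f zero * 4 + (load f j + (∑[ k < n ] hub k * 4 + n * 3))
                                                     ≡⟨ regroup (f zero) _ (load f j) (n * 3) ⟩
    hub-total * 4 + load f j + n * 3                 ∎)
    where
    open ≤-Reasoning
    hub : Fin n → ℕ
    hub k = collected k 0F

    load≤collected : ∀ k → k ≢ j → load f k ≤ hub k * 4 + 3
    load≤collected k k≢j with k ≟ j
    ... | yes k≡j = contradiction k≡j k≢j
    ... | no _    = quarter-bound (load f k)

    load-j : 3 + load f j ≤ load f j + (hub j * 4 + 3)
    load-j rewrite collected-j = ≤-reflexive (+-comm 3 (load f j))

    sum-hub : ∑[ k < n ] (hub k * 4 + 3) ≡ ∑[ k < n ] hub k * 4 + n * 3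
    sum-hub = trans (∑-distrib-+ (λ k → hub k * 4) (λ _ → 3))
                    (cong₂ _+_ (sym (*-distribʳ-sum 4 hub)) (sum-const n 3))

    shift : ∀ n → 13 + n * 3 ≡ 3 + (3 * n + 10)
    shift = solve-∀

    regroup : ∀ a s l t → a * 4 + (l + (s * 4 + t)) ≡ (a + s) * 4 + l + t
    regroup = solve-∀

pebbles-on-cycles : ∀ {n} (f : Config (F4 n)) → weight (F4 n) f ≡ 3 * n + 10 → ∀ j t → Pebbles (F4 n) f (cyc j t)
pebbles-on-cycles {n} f weight≡ j t =
  ⇝-pebbles gather (pebbles-push (cycle j) (cycle-solvable (enough weight≡) t))
  where open Gathering {n} f j

-- Potentials

Ψ : (ℕ → ℕ → ℕ → ℕ) → Config C4 → ℕ
Ψ φ e = e 0F + φ (e 1F) (e 2F) (e 3F)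

-- Δᵤᵥ says that a move from u to v in C4 does not increase Ψ φ.
record CyclePotential (φ : ℕ → ℕ → ℕ → ℕ) : Set where
  field
    Δ₀₁ : ∀ x y z → φ (suc x) y z ≤ φ x y z + 2
    Δ₀₃ : ∀ x y z → φ x y (suc z) ≤ φ x y z + 2
    Δ₁₀ : ∀ x y z → φ x y z + 1 ≤ φ (2 + x) y z
    Δ₃₀ : ∀ x y z → φ x y z + 1 ≤ φ x y (2 + z)
    Δ₁₂ : ∀ x y z → φ x (suc y) z ≤ φ (2 + x) y z
    Δ₂₁ : ∀ x y z → φ (suc x) y z ≤ φ x (2 + y) z
    Δ₂₃ : ∀ x y z → φ x y (suc z) ≤ φ x (2 + y) z
    Δ₃₂ : ∀ x y z → φ x (suc y) z ≤ φ x y (2 + z)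

Ψ-cong : ∀ φ {e e′ : Config C4} → (∀ x → e x ≡ e′ x) → Ψ φ e ≡ Ψ φ e′
Ψ-cong φ e≗e′ rewrite e≗e′ 0F | e≗e′ 1F | e≗e′ 2F | e≗e′ 3F = refl

≥2-elim : ∀ {x} (g h : ℕ → ℕ) → 2 ≤ x → (∀ x′ → g x′ ≤ h (2 + x′)) → g (x ∸ 2) ≤ h x
≥2-elim g h (s≤s (s≤s _)) g≤h = g≤h _

hub-out : ∀ {h a b} → 2 ≤ h → a ≤ b + 2 → h ∸ 2 + a ≤ h + b
hub-out {suc (suc h)} {a} {b} (s≤s (s≤s _)) a≤ =
  ≤-trans (+-monoʳ-≤ h a≤) (≤-reflexive (trans (sym (+-assoc h b 2)) (+-comm (h + b) 2)))

hub-in : ∀ {h a b} → a + 1 ≤ b → suc h + a ≤ h + b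
hub-in {h} {a} a+1≤b =
  ≤-trans (≤-reflexive (sym (trans (cong (h +_) (+-comm a 1)) (+-suc h a)))) (+-monoʳ-≤ h a+1≤b)

module _ {φ} (pot : CyclePotential φ) where
  open CyclePotential pot

  Ψ-step : ∀ {e e′ : Config C4} → Step C4 e e′ → Ψ φ e′ ≤ Ψ φ e
  Ψ-step {e} (step _ _ 0→1 2≤) = hub-out 2≤ (Δ₀₁ (e 1F) (e 2F) (e 3F))
  Ψ-step {e} (step _ _ 0→3 2≤) = hub-out 2≤ (Δ₀₃ (e 1F) (e 2F) (e 3F))
  Ψ-step {e} (step _ _ 1→0 2≤) =
    ≥2-elim (λ t → suc (e 0F) + φ t (e 2F) (e 3F)) (λ t → e 0F + φ t (e 2F) (e 3F)) 2≤
          (λ t → hub-in (Δ₁₀ t (e 2F) (e 3F)))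
  Ψ-step {e} (step _ _ 3→0 2≤) =
    ≥2-elim (λ t → suc (e 0F) + φ (e 1F) (e 2F) t) (λ t → e 0F + φ (e 1F) (e 2F) t) 2≤
          (λ t → hub-in (Δ₃₀ (e 1F) (e 2F) t))
  Ψ-step {e} (step _ _ 1→2 2≤) =
    +-monoʳ-≤ (e 0F) (≥2-elim (λ t → φ t (suc (e 2F)) (e 3F)) (λ t → φ t (e 2F) (e 3F)) 2≤
                        (λ t → Δ₁₂ t (e 2F) (e 3F)))
  Ψ-step {e} (step _ _ 2→1 2≤) =
    +-monoʳ-≤ (e 0F) (≥2-elim (λ t → φ (suc (e 1F)) t (e 3F)) (λ t → φ (e 1F) t (e 3F)) 2≤
                        (λ t → Δ₂₁ (e 1F) t (e 3F)))
  Ψ-step {e} (step _ _ 2→3 2≤) =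
    +-monoʳ-≤ (e 0F) (≥2-elim (λ t → φ (e 1F) t (suc (e 3F))) (λ t → φ (e 1F) t (e 3F)) 2≤
                        (λ t → Δ₂₃ (e 1F) t (e 3F)))
  Ψ-step {e} (step _ _ 3→2 2≤) =
    +-monoʳ-≤ (e 0F) (≥2-elim (λ t → φ (e 1F) (suc (e 2F)) t) (λ t → φ (e 1F) (e 2F) t) 2≤
                        (λ t → Δ₃₂ (e 1F) (e 2F) t))

module Potential {n} (φ : Fin n → ℕ → ℕ → ℕ → ℕ) (pot : ∀ k → CyclePotential (φ k)) where

  term : Config (F4 n) → Fin n → ℕ
  term g k = φ k (g (c k 0F)) (g (c k 1F)) (g (c k 2F))

  Φ : Config (F4 n) → ℕ
  Φ g = g zero + ∑[ k < n ] term g k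

  term-≡ : ∀ g k {x y z} → g (c k 0F) ≡ x → g (c k 1F) ≡ y → g (c k 2F) ≡ z → term g k ≡ φ k x y z
  term-≡ g k refl refl refl = refl

  Φ-cycle-step : ∀ {g} i {u v} → C4Adj u v → 2 ≤ g (cyc i u) → Φ (move (F4 n) g (cyc i u) (cyc i v)) ≤ Φ g
  Φ-cycle-step {g} i {u} {v} uv 2≤ = sum-≤-except i local others
    where
    g′ = move (F4 n) g (cyc i u) (cyc i v)
    local : g′ zero + term g′ i ≤ g zero + term g i
    local = ≤-trans (≤-reflexive (Ψ-cong (φ i) (move-vertex (cycle i) g u v)))
                    (Ψ-step (pot i) {g ∘ cyc i} (step u v uv 2≤))
    others : ∀ k → k ≢ i → term g′ k ≤ term g k
    others k k≢i = ≤-reflexive (term-≡ g′ k (unmoved 0F) (unmoved 1F) (unmoved 2F))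
      where
      unmoved : ∀ r → g′ (c k r) ≡ g (c k r)
      unmoved r = move-other {F4 n} g (c≢cyc r u k≢i) (c≢cyc r v k≢i)

  Φ-step : ∀ {g g′} → Step (F4 n) g g′ → Φ g′ ≤ Φ g
  Φ-step {g} (step _ _ (hub-0 i) 2≤) = Φ-cycle-step {g} i 0→1 2≤
  Φ-step {g} (step _ _ (0-hub i) 2≤) = Φ-cycle-step {g} i 1→0 2≤
  Φ-step {g} (step _ _ (0-1 i)   2≤) = Φ-cycle-step {g} i 1→2 2≤
  Φ-step {g} (step _ _ (1-0 i)   2≤) = Φ-cycle-step {g} i 2→1 2≤
  Φ-step {g} (step _ _ (1-2 i)   2≤) = Φ-cycle-step {g} i 2→3 2≤
  Φ-step {g} (step _ _ (2-1 i)   2≤) = Φ-cycle-step {g} i 3→2 2≤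
  Φ-step {g} (step _ _ (2-hub i) 2≤) = Φ-cycle-step {g} i 3→0 2≤
  Φ-step {g} (step _ _ (hub-2 i) 2≤) = Φ-cycle-step {g} i 0→3 2≤

  Φ-reach : ∀ {g g′} → Reach (F4 n) g g′ → Φ g′ ≤ Φ g
  Φ-reach ε            = ≤-refl
  Φ-reach (s ◅ reach) = ≤-trans (Φ-reach reach) (Φ-step s)

  term≤Φ : ∀ g k → term g k ≤ Φ g
  term≤Φ g k = ≤-trans (term≤sum (term g) k) (m≤n+m _ (g zero))

  out-of-reach : ∀ {f} k r {b} → (∀ g → 1 ≤ g (c k r) → b ≤ term g k) → Φ f < b → ¬ Pebbles (F4 n) f (c k r)
  out-of-reach k r needs Φ<b (g , reach , 1≤) =
    <⇒≱ Φ<b (≤-trans (needs g 1≤) (≤-trans (term≤Φ g k) (Φ-reach reach)))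

≤-by : ∀ k {m n} → n ≡ k + m → m ≤ n
≤-by k {m} n≡k+m = subst (m ≤_) (sym n≡k+m) (m≤n+m m k)

rim : (ℕ → ℕ) → ℕ → ℕ → ℕ → ℕ
rim μ x y z = 2 * x + μ y + 2 * z

rim-potential : ∀ μ → (∀ y → μ (suc y) ≤ μ y + 4) → (∀ y → μ y + 2 ≤ μ (2 + y)) → CyclePotential (rim μ)
rim-potential μ up down = record
  { Δ₀₁ = λ x y z → ≤-reflexive (out-x x (μ y) z)
  ; Δ₀₃ = λ x y z → ≤-reflexive (out-z x (μ y) z)
  ; Δ₁₀ = λ x y z → ≤-by 3 (in-x x (μ y) z)
  ; Δ₃₀ = λ x y z → ≤-by 3 (in-z x (μ y) z)
  ; Δ₁₂ = λ x y z → ≤-trans (+-monoˡ-≤ (2 * z) (+-monoʳ-≤ (2 * x) (up y))) (≤-reflexive (to-x x (μ y) z))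
  ; Δ₃₂ = λ x y z → ≤-trans (+-monoˡ-≤ (2 * z) (+-monoʳ-≤ (2 * x) (up y))) (≤-reflexive (to-z x (μ y) z))
  ; Δ₂₁ = λ x y z → ≤-trans (≤-reflexive (from-x x (μ y) z)) (+-monoˡ-≤ (2 * z) (+-monoʳ-≤ (2 * x) (down y)))
  ; Δ₂₃ = λ x y z → ≤-trans (≤-reflexive (from-z x (μ y) z)) (+-monoˡ-≤ (2 * z) (+-monoʳ-≤ (2 * x) (down y)))
  }
  where
  out-x : ∀ x w z → 2 * suc x + w + 2 * z ≡ 2 * x + w + 2 * z + 2
  out-x = solve-∀
  out-z : ∀ x w z → 2 * x + w + 2 * suc z ≡ 2 * x + w + 2 * z + 2
  out-z = solve-∀
  in-x : ∀ x w z → 2 * (2 + x) + w + 2 * z ≡ 3 + (2 * x + w + 2 * z + 1)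
  in-x = solve-∀
  in-z : ∀ x w z → 2 * x + w + 2 * (2 + z) ≡ 3 + (2 * x + w + 2 * z + 1)
  in-z = solve-∀
  to-x : ∀ x w z → 2 * x + (w + 4) + 2 * z ≡ 2 * (2 + x) + w + 2 * z
  to-x = solve-∀
  to-z : ∀ x w z → 2 * x + (w + 4) + 2 * z ≡ 2 * x + w + 2 * (2 + z)
  to-z = solve-∀
  from-x : ∀ x w z → 2 * suc x + w + 2 * z ≡ 2 * x + (w + 2) + 2 * z
  from-x = solve-∀
  from-z : ∀ x w z → 2 * x + w + 2 * suc z ≡ 2 * x + (w + 2) + 2 * z
  from-z = solve-∀

φ-opposite : ℕ → ℕ → ℕ → ℕ
φ-opposite = rim (4 *_)

φ-opposite-potential : CyclePotential φ-opposite
φ-opposite-potential = rim-potential (4 *_) (λ y → ≤-reflexive (solve (y ∷ [])))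
                                             (λ y → ≤-by 6 (solve (y ∷ [])))

φ-neighbour : ℕ → ℕ → ℕ → ℕ
φ-neighbour = rim (λ y → 2 * ⌊ y /2⌋)

φ-neighbour-potential : CyclePotential φ-neighbour
φ-neighbour-potential = rim-potential (λ y → 2 * ⌊ y /2⌋)
  (λ y → ≤-trans (*-monoʳ-≤ 2 (⌊n/2⌋-mono (n≤1+n (suc y))))
                 (≤-by 2 (trans (+-comm (2 * ⌊ y /2⌋) 4) (cong (2 +_) (sym (*-suc 2 ⌊ y /2⌋))))))
  (λ y → ≤-reflexive (trans (+-comm (2 * ⌊ y /2⌋) 2) (sym (*-suc 2 ⌊ y /2⌋))))

φ-yield : ℕ → ℕ → ℕ → ℕ
φ-yield x y z = (2 * x + y + 2 * z) / 4

quarter-+ : ∀ b c → (b + c * 4) / 4 ≡ b / 4 + c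
quarter-+ b c = trans (+-distrib-/-∣ʳ b (n∣m*n c)) (cong (b / 4 +_) (m*n/n≡m c 4))

quarter-≤ : ∀ a b c → a ≤ b + c * 4 → a / 4 ≤ b / 4 + c
quarter-≤ a b c a≤ = ≤-trans (/-monoˡ-≤ 4 a≤) (≤-reflexive (quarter-+ b c))

quarter-≡ : ∀ a b c → a ≡ b + c * 4 → b / 4 + c ≡ a / 4
quarter-≡ a b c a≡ = sym (trans (cong (_/ 4) a≡) (quarter-+ b c))

φ-yield-potential : CyclePotential φ-yield
φ-yield-potential = record
  { Δ₀₁ = λ x y z → quarter-≤ (2 * suc x + y + 2 * z) (2 * x + y + 2 * z) 2 (≤-by 6 (solve (x ∷ y ∷ z ∷ [])))
  ; Δ₀₃ = λ x y z → quarter-≤ (2 * x + y + 2 * suc z) (2 * x + y + 2 * z) 2 (≤-by 6 (solve (x ∷ y ∷ z ∷ [])))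
  ; Δ₁₀ = λ x y z → ≤-reflexive (quarter-≡ (2 * (2 + x) + y + 2 * z) (2 * x + y + 2 * z) 1 (solve (x ∷ y ∷ z ∷ [])))
  ; Δ₃₀ = λ x y z → ≤-reflexive (quarter-≡ (2 * x + y + 2 * (2 + z)) (2 * x + y + 2 * z) 1 (solve (x ∷ y ∷ z ∷ [])))
  ; Δ₁₂ = λ x y z → /-monoˡ-≤ {2 * x + suc y + 2 * z} {2 * (2 + x) + y + 2 * z} 4 (≤-by 3 (solve (x ∷ y ∷ z ∷ [])))
  ; Δ₃₂ = λ x y z → /-monoˡ-≤ {2 * x + suc y + 2 * z} {2 * x + y + 2 * (2 + z)} 4 (≤-by 3 (solve (x ∷ y ∷ z ∷ [])))
  ; Δ₂₁ = λ x y z → ≤-reflexive (cong (_/ 4) {2 * suc x + y + 2 * z} {2 * x + (2 + y) + 2 * z} (solve (x ∷ y ∷ z ∷ [])))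
  ; Δ₂₃ = λ x y z → ≤-reflexive (cong (_/ 4) {2 * x + y + 2 * suc z} {2 * x + (2 + y) + 2 * z} (solve (x ∷ y ∷ z ∷ [])))
  }

φ-opposite-reached : ∀ x {y} z → 1 ≤ y → 4 ≤ φ-opposite x y z
φ-opposite-reached x {y} z 1≤y = ≤-trans (*-monoʳ-≤ 4 1≤y) (≤-trans (m≤n+m (4 * y) (2 * x)) (m≤m+n _ (2 * z)))

φ-neighbour-reached : ∀ {x} y z → 1 ≤ x → 2 ≤ φ-neighbour x y z
φ-neighbour-reached {x} y z 1≤x = ≤-trans (*-monoʳ-≤ 2 1≤x) (≤-trans (m≤m+n (2 * x) _) (m≤m+n _ (2 * z)))

φ-opposite-≤ : ∀ x y z → φ-opposite x y z ≤ (x + y + z) * 4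
φ-opposite-≤ x y z = ≤-by (2 * x + 2 * z) {2 * x + 4 * y + 2 * z} (solve (x ∷ y ∷ z ∷ []))

φ-yield-half : ∀ x y z → φ-yield x y z * 2 ≤ x + y + z
φ-yield-half x y z = *-cancelʳ-≤ _ _ 2 (begin
  φ-yield x y z * 2 * 2         ≡⟨ *-assoc (φ-yield x y z) 2 2 ⟩
  φ-yield x y z * 4             ≤⟨ m/n*n≤m (2 * x + y + 2 * z) 4 ⟩
  2 * x + y + 2 * z             ≤⟨ ≤-by y (solve (x ∷ y ∷ z ∷ [])) ⟩
  (x + y + z) * 2               ∎)
  where open ≤-Reasoning

half-+1 : ∀ {q s} → q * 2 ≤ s → 1 ≤ s → q + 1 ≤ s
half-+1 {zero}  _    1≤s = 1≤s
half-+1 {suc q} 2q≤s _   = ≤-trans (s≤s (≤-trans (≤-reflexive (+-comm q 1)) (s≤s (m≤m*n q 2)))) 2q≤s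

φ-yield-below : ∀ x y z → 1 ≤ x + y + z → φ-yield x y z + 1 ≤ x + y + z
φ-yield-below x y z = half-+1 (φ-yield-half x y z)

single-near : ∀ x y z → x + y + z ≡ 1 → y ≢ 0 → φ-neighbour x y z + 1 ≤ 0 + (x + y + z)
single-near 0 1 0 _ _ = ≤-refl
single-near x 0 z _ y≢0 = contradiction refl y≢0
single-near 0 (suc (suc y)) z () _
single-near 0 1 (suc z) () _
single-near 1 (suc y) z () _
single-near (suc (suc x)) y z () _

single-far : ∀ x y z → x + y + z ≡ 1 → y ≡ 0 → φ-opposite x y z + 1 ≤ 2 + (x + y + z)
single-far 1 0 0 _ _ = ≤-refl
single-far 0 0 1 _ _ = ≤-refl
single-far x (suc y) z _ ()
single-far 0 0 0 () _
single-far 1 0 (suc z) () _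
single-far 0 0 (suc (suc z)) () _
single-far (suc (suc x)) 0 z () _

-- Light configurations

focus : ∀ {n} → Fin n → (ℕ → ℕ → ℕ → ℕ) → Fin n → ℕ → ℕ → ℕ → ℕ
focus j φ k = if ⌊ k ≟ j ⌋ then φ else φ-yield

focus-potential : ∀ {n} (j : Fin n) {φ} → CyclePotential φ → ∀ k → CyclePotential (focus j φ k)
focus-potential j pot k with k ≟ j
... | yes _ = pot
... | no _  = φ-yield-potential

focus-here : ∀ {n} (j : Fin n) φ x y z → focus j φ j x y z ≡ φ x y z
focus-here j φ x y z with j ≟ j
... | yes _   = refl
... | no j≢j = contradiction refl j≢j

focus-elsewhere : ∀ {n} {j k : Fin n} φ x y z → k ≢ j → focus j φ k x y z ≡ φ-yield x y z
focus-elsewhere {j = j} {k} φ x y z k≢j with k ≟ j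
... | yes k≡j = contradiction k≡j k≢j
... | no _    = refl

module TargetPotential {n} (j : Fin n) {φ} (pot : CyclePotential φ) where
  open Potential (focus j φ) (focus-potential j pot) public

  term-here : ∀ g → term g j ≡ φ (g (c j 0F)) (g (c j 1F)) (g (c j 2F))
  term-here g = focus-here j φ _ _ _

  budget : ∀ (f : Config (F4 n)) d → (∀ k → 1 ≤ load f k) →
           φ (f (c j 0F)) (f (c j 1F)) (f (c j 2F)) + 1 ≤ d + load f j → Φ f + n ≤ weight (F4 n) f + d
  budget f d nonempty at-j = begin
    f zero + ∑[ k < n ] term f k + n              ≡⟨ +-assoc (f zero) _ n ⟩
    f zero + (∑[ k < n ] term f k + n)            ≡⟨ cong (f zero +_) (sym sum-+1) ⟩
    f zero + ∑[ k < n ] (term f k + 1)            ≤⟨ +-monoʳ-≤ (f zero) (sum-≤-except j {c = 0} here elsewhere) ⟩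
    f zero + (d + ∑[ k < n ] load f k)            ≡⟨ x∙yz≈xz∙y (f zero) d _ ⟩
    f zero + ∑[ k < n ] load f k + d              ≡⟨ cong (_+ d) (sym (weight-F4 {n} f)) ⟩
    weight (F4 n) f + d                           ∎
    where
    open ≤-Reasoning
    sum-+1 : ∑[ k < n ] (term f k + 1) ≡ ∑[ k < n ] term f k + n
    sum-+1 = trans (∑-distrib-+ (term f) (λ _ → 1))
                   (cong (∑[ k < n ] term f k +_) (trans (sum-const n 1) (*-identityʳ n)))
    here : term f j + 1 ≤ d + load f j
    here = subst (λ t → t + 1 ≤ d + load f j) (sym (term-here f)) at-j
    elsewhere : ∀ k → k ≢ j → term f k + 1 ≤ load f k
    elsewhere k k≢j = subst (λ t → t + 1 ≤ load f k) (sym (focus-elsewhere φ _ _ _ k≢j))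
                            (φ-yield-below (f (c k 0F)) (f (c k 1F)) (f (c k 2F)) (nonempty k))

module _ {n} (f : Config (F4 n)) where

  empty-petal : ∀ j → load f j ≡ 0 → f zero + weight (F4 n) f ≤ 7 → ¬ Pebbles (F4 n) f (c j 1F)
  empty-petal j empty tiny = out-of-reach j 1F needs (double<8 (begin
    Φ f * 2                                          ≡⟨ *-distribʳ-+ 2 (f zero) _ ⟩
    f zero * 2 + ∑[ k < n ] term f k * 2             ≡⟨ cong (f zero * 2 +_) (*-distribʳ-sum 2 (term f)) ⟩
    f zero * 2 + ∑[ k < n ] (term f k * 2)           ≤⟨ +-monoʳ-≤ (f zero * 2) (sum-mono halves) ⟩
    f zero * 2 + ∑[ k < n ] load f k                 ≡⟨ regroup (f zero) _ ⟩
    f zero + (f zero + ∑[ k < n ] load f k)          ≡⟨ cong (f zero +_) (sym (weight-F4 {n} f)) ⟩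
    f zero + weight (F4 n) f                         ≤⟨ tiny ⟩
    7                                                ∎))
    where
    open ≤-Reasoning
    open TargetPotential j φ-opposite-potential
    needs : ∀ g → 1 ≤ g (c j 1F) → 4 ≤ term g j
    needs g 1≤ = subst (4 ≤_) (sym (term-here g)) (φ-opposite-reached (g (c j 0F)) (g (c j 2F)) 1≤)
    halves : ∀ k → term f k * 2 ≤ load f k
    halves k with k ≟ j
    ... | yes refl = ≤-trans (*-monoˡ-≤ 2 (≤-trans (φ-opposite-≤ (f (c k 0F)) (f (c k 1F)) (f (c k 2F)))
                                                   (≤-reflexive (cong (_* 4) empty))))
                             z≤n
    ... | no _     = φ-yield-half (f (c k 0F)) (f (c k 1F)) (f (c k 2F))
    double<8 : ∀ {m} → m * 2 ≤ 7 → m < 4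
    double<8 {m} 2m≤7 = ≰⇒> λ 4≤m → <-irrefl refl (≤-trans (*-monoˡ-≤ 2 4≤m) 2m≤7)
    regroup : ∀ a s → a * 2 + s ≡ a + (a + s)
    regroup = solve-∀

  single-petal : ∀ j → load f j ≡ 1 → (∀ k → 1 ≤ load f k) → weight (F4 n) f ≤ n + 1 → ¬ Solvable (F4 n) f
  single-petal j single nonempty light solvable with f (c j 1F) ≟ℕ 0
  ... | no middle≢0 =
    out-of-reach j 0F needs (s≤s (+-cancelʳ-≤ n _ 1 (begin
      Φ f + n                ≤⟨ budget f 0 nonempty at-j ⟩
      weight (F4 n) f + 0    ≤⟨ +-monoˡ-≤ 0 light ⟩
      n + 1 + 0              ≡⟨ +-identityʳ _ ⟩
      n + 1                  ≡⟨ +-comm n 1 ⟩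
      1 + n                  ∎)))
      (solvable (c j 0F))
    where
    open ≤-Reasoning
    open TargetPotential j φ-neighbour-potential
    at-j = single-near (f (c j 0F)) (f (c j 1F)) (f (c j 2F)) single middle≢0
    needs : ∀ g → 1 ≤ g (c j 0F) → 2 ≤ term g j
    needs g 1≤ = subst (2 ≤_) (sym (term-here g)) (φ-neighbour-reached (g (c j 1F)) (g (c j 2F)) 1≤)
  ... | yes middle≡0 =
    out-of-reach j 1F needs (s≤s (+-cancelʳ-≤ n _ 3 (begin
      Φ f + n                ≤⟨ budget f 2 nonempty at-j ⟩
      weight (F4 n) f + 2    ≤⟨ +-monoˡ-≤ 2 light ⟩
      n + 1 + 2              ≡⟨ solve-3 n ⟩
      3 + n                  ∎)))
      (solvable (c j 1F))
    where
    open ≤-Reasoning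
    open TargetPotential j φ-opposite-potential
    at-j = single-far (f (c j 0F)) (f (c j 1F)) (f (c j 2F)) single middle≡0
    needs : ∀ g → 1 ≤ g (c j 1F) → 4 ≤ term g j
    needs g 1≤ = subst (4 ≤_) (sym (term-here g)) (φ-opposite-reached (g (c j 0F)) (g (c j 2F)) 1≤)
    solve-3 : ∀ n → n + 1 + 2 ≡ 3 + n
    solve-3 = solve-∀

  crowded : (∀ (k : Fin n) → 2 ≤ load f k) → 2 ≤ n → weight (F4 n) f ≤ n + 1 → ⊥
  crowded full 2≤n light = <-irrefl refl (+-cancelˡ-≤ n 2 1 (begin
    n + 2 ≤⟨ +-monoʳ-≤ n 2≤n ⟩
    n + n                          ≡⟨ cong (n +_) (sym (+-identityʳ n)) ⟩
    2 * n                          ≡⟨ *-comm 2 n ⟩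
    n * 2                          ≡⟨ sum-const n 2 ⟨
    ∑[ k < n ] 2                   ≤⟨ sum-mono full ⟩
    ∑[ k < n ] load f k            ≤⟨ m≤n+m _ (f zero) ⟩
    f zero + ∑[ k < n ] load f k   ≡⟨ weight-F4 {n} f ⟨
    weight (F4 n) f                ≤⟨ light ⟩
    n + 1                          ∎))
    where open ≤-Reasoning

unsolvable-light : ∀ {n} (f : Config (F4 n)) → 2 ≤ n →
                   weight (F4 n) f ≤ n + 1 → f zero + weight (F4 n) f ≤ 7 → ¬ Solvable (F4 n) f
unsolvable-light {n} f 2≤n light tiny solvable with any? {n} (λ k → load f k ≟ℕ 0)
... | yes (j , empty) = empty-petal {n} f j empty tiny (solvable (c j 1F))
... | no no-empty with any? {n} (λ k → load f k ≤? 1)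
...   | yes (j , ≤1) = single-petal {n} f j (≤-antisym ≤1 (nonempty j)) nonempty light solvable
  where
  nonempty : ∀ k → 1 ≤ load f k
  nonempty k = n≢0⇒n>0 (no-empty ∘ (k ,_))
...   | no no-single = crowded {n} f (λ k → ≰⇒> (no-single ∘ (k ,_))) 2≤n light

-- The pebbling numbers

heavy : ∀ {m} → Fin (2 + m) → Fin 3 → ℕ
heavy 1F            1F = 15
heavy (suc (suc _)) 1F = 3
heavy _             _  = 0

unbalanced : ∀ m → Config (F4 (2 + m))
unbalanced m = assemble 0 (heavy {m})

unbalanced-weight : ∀ m → weight (F4 (2 + m)) (unbalanced m) ≡ 3 * (2 + m) + 9
unbalanced-weight m = trans (weight-assemble {2 + m} 0 heavy) (trans (cong (15 +_) (sum-const m 3)) (arith m))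
  where
  arith : ∀ m → 15 + m * 3 ≡ 3 * (2 + m) + 9
  arith = solve-∀

unbalanced-unsolvable : ∀ m → ¬ Solvable (F4 (2 + m)) (unbalanced m)
unbalanced-unsolvable m solvable = out-of-reach first 1F needs Φ<4 (solvable (c first 1F))
  where
  first : Fin (2 + m)
  first = 0F
  open TargetPotential first φ-opposite-potential
  needs : ∀ g → 1 ≤ g (c first 1F) → 4 ≤ term g first
  needs g 1≤ = φ-opposite-reached (g (c first 0F)) (g (c first 2F)) 1≤
  Φ<4 : Φ (unbalanced m) < 4
  Φ<4 = s≤s (≤-reflexive (cong (3 +_) (sum-zero {m} λ i →
          term-≡ (unbalanced m) (suc (suc i)) (value i 0F) (value i 1F) (value i 2F))))
    where
    value : ∀ i r → unbalanced m (c (suc (suc i)) r) ≡ heavy (suc (suc i)) r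
    value i = assemble-c 0 heavy (suc (suc i))

pebbling-number : ∀ m → PebblingNumber (F4 (2 + m)) (3 * (2 + m) + 10)
pebbling-number m =
  (λ f weight≡ → solvable-by-cycles (pebbles-on-cycles f weight≡)) ,
  λ k k<π all-solvable →
    let k≤ = ≤-trans (≤-pred (≤-trans k<π (≤-reflexive (+-suc (3 * (2 + m)) 9))))
                     (≤-reflexive (sym (unbalanced-weight m)))
        g , g≤ , weight≡k = shrink-sum (unbalanced m) k≤
    in  unbalanced-unsolvable m (solvable-mono g≤ (all-solvable g weight≡k))

hub≤weight : ∀ {n} (f : Config (F4 n)) → f zero ≤ weight (F4 n) f
hub≤weight {n} f = ≤-trans (m≤m+n (f zero) _) (≤-reflexive (sym (weight-F4 {n} f)))

cfg4000-solvable : Solvable C4 (cfg 4 0 0 0)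
cfg4000-solvable = cycle-solvable (from-yes (13 ≤? 16))

hub-only-solvable : ∀ m → Solvable (F4 (suc m)) (hub-only {suc m} 4)
hub-only-solvable m = solvable-by-petals cfg4000-solvable λ k → push-≤ (cycle k) λ
  { 0F → ≤-refl ; 1F → z≤n ; 2F → z≤n ; 3F → z≤n }

hub-only-weight : ∀ {n} h → weight (F4 n) (hub-only {n} h) ≡ h
hub-only-weight {n} h =
  trans (weight-F4 {n} (hub-only {n} h)) (trans (cong (h +_) (sum-zero {n} λ _ → refl)) (+-identityʳ h))

optimal-number : ∀ m → OptimalPebblingNumber (F4 (2 + m)) 4
optimal-number m =
  (hub-only {2 + m} 4 , hub-only-weight {2 + m} 4 , hub-only-solvable (suc m)) ,
  λ k k<4 (f , weight≡k , solvable) →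
    let w≤3 = ≤-trans (≤-reflexive weight≡k) (≤-pred k<4)
    in  unsolvable-light {2 + m} f 2≤2+m (≤-trans w≤3 (+-monoˡ-≤ 1 2≤2+m))
          (≤-trans (+-mono-≤ (≤-trans (hub≤weight {2 + m} f) w≤3) w≤3) (from-yes (6 ≤? 7))) solvable
  where
  2≤2+m : 2 ≤ 2 + m
  2≤2+m = s≤s (s≤s z≤n)

middle-only : Fin 3 → ℕ
middle-only 1F = 1
middle-only _  = 0

spread : ∀ n → Config (F4 n)
spread n = assemble {n} 2 (λ _ → middle-only)

spread-two-restricted : ∀ n → TwoRestricted (F4 n) (spread n)
spread-two-restricted n =
  by-vertex {n} ≤-refl λ k r → ≤-trans (≤-reflexive (assemble-c 2 (λ _ → middle-only) k r)) (bound r)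
  where
  bound : ∀ r → middle-only r ≤ 2
  bound 0F = z≤n
  bound 1F = s≤s z≤n
  bound 2F = z≤n

cfg2010-solvable : Solvable C4 (cfg 2 0 1 0)
cfg2010-solvable 0F = pebble-present (s≤s z≤n)
cfg2010-solvable 1F = hub-to-1 ≤-refl
cfg2010-solvable 2F = pebble-present ≤-refl
cfg2010-solvable 3F = hub-to-3 ≤-refl

spread-solvable : ∀ m → Solvable (F4 (suc m)) (spread (suc m))
spread-solvable m = solvable-by-petals cfg2010-solvable λ k → push-≤ (cycle k) λ
  { 0F → ≤-refl ; 1F → z≤n ; 2F → ≤-reflexive (sym (assemble-c 2 (λ _ → middle-only) k 1F)) ; 3F → z≤n }

flanking : ∀ {m} → Fin (suc m) → Fin 3 → ℕ
flanking 0F 0F = 2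
flanking 0F 2F = 2
flanking _  _  = 0

flanked : ∀ m → Config (F4 (suc m))
flanked m = assemble 2 (flanking {m})

flanked-weight : ∀ m → weight (F4 (suc m)) (flanked m) ≡ 6
flanked-weight m =
  trans (weight-assemble {suc m} 2 flanking) (cong (λ t → 2 + (4 + t)) (sum-zero {m} λ _ → refl))

flanked-two-restricted : ∀ m → TwoRestricted (F4 (suc m)) (flanked m)
flanked-two-restricted m =
  by-vertex {suc m} ≤-refl λ k r → ≤-trans (≤-reflexive (assemble-c 2 flanking k r)) (bound k r)
  where
  bound : ∀ k r → flanking {m} k r ≤ 2
  bound 0F      0F = ≤-refl
  bound 0F      1F = z≤n
  bound 0F      2F = ≤-refl
  bound (suc _) _  = z≤n

flanked-solvable : ∀ m → Solvable (F4 (suc m)) (flanked m)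
flanked-solvable m = solvable-⇝ to-hub (solvable-mono hub-only≤ (hub-only-solvable m))
  where
  first : Fin (suc m)
  first = 0F
  to-hub : flanked m ⇝[ F4 (suc m) ] push (cycle first) (cfg 4 0 0 0)
  to-hub = ⇝-weaken (push-≤ (cycle first) λ { 0F → ≤-refl ; 1F → ≤-refl ; 2F → z≤n ; 3F → ≤-refl })
                    (λ _ → ≤-refl) (⇝-push (cycle first) (⇝-trans move₁₀ move₃₀))
  hub-only≤ : hub-only 4 ≤ᶜ push (cycle first) (cfg 4 0 0 0)
  hub-only≤ zero    = ≤-reflexive (sym (push-vertex (cycle first) (cfg 4 0 0 0) 0F))
  hub-only≤ (suc _) = z≤n

restricted-lower : ∀ {n} → 2 ≤ n → ∀ {k} → k ≤ n + 1 → k ≤ 5 →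
  ¬ Σ (Config (F4 n)) λ f → weight (F4 n) f ≡ k × TwoRestricted (F4 n) f × Solvable (F4 n) f
restricted-lower {n} 2≤n k≤n+1 k≤5 (f , refl , restricted , solvable) =
  unsolvable-light {n} f 2≤n k≤n+1 (+-mono-≤ (restricted zero) k≤5) solvable

mainTheorem2 : (n : ℕ) → 2 ≤ n →
    PebblingNumber (F4 n) (3 * n + 10)
    × OptimalPebblingNumber (F4 n) 4
    × (n ≡ 2 → TwoRestrictedOptimalPebblingNumber (F4 n) 4)
    × (n ≡ 3 → TwoRestrictedOptimalPebblingNumber (F4 n) 5)
    × (4 ≤ n → TwoRestrictedOptimalPebblingNumber (F4 n) 6)
mainTheorem2 (suc (suc m)) 2≤n@(s≤s (s≤s _)) = pebbling-number m , optimal-number m , n≡2 , n≡3 , 4≤n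
  where
  n≡2 : 2 + m ≡ 2 → TwoRestrictedOptimalPebblingNumber (F4 (2 + m)) 4
  n≡2 refl = (spread 2 , refl , spread-two-restricted 2 , spread-solvable 1) ,
             λ k k<4 → restricted-lower 2≤n (≤-pred k<4) (≤-trans (≤-pred k<4) (from-yes (3 ≤? 5)))
  n≡3 : 2 + m ≡ 3 → TwoRestrictedOptimalPebblingNumber (F4 (2 + m)) 5
  n≡3 refl = (spread 3 , refl , spread-two-restricted 3 , spread-solvable 2) ,
             λ k k<5 → restricted-lower 2≤n (≤-pred k<5) (≤-trans (≤-pred k<5) (from-yes (4 ≤? 5)))
  4≤n : 4 ≤ 2 + m → TwoRestrictedOptimalPebblingNumber (F4 (2 + m)) 6
  4≤n 4≤2+m = (flanked (suc m) , flanked-weight (suc m) , flanked-two-restricted (suc m) ,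
               flanked-solvable (suc m)) ,
              λ k k<6 → restricted-lower 2≤n (≤-trans (≤-pred k<6) (+-monoˡ-≤ 1 4≤2+m)) (≤-pred k<6)
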